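{- For every integer $n\geqslant 0$, the number of maximal chains in the poset $\Sigma_n C_1^n$ (the stacking of the hypercubes $C_1^0\to C_1^1\to\dots\to C_1^n$) equals the odd double factorial $(2n-1)!!=\frac{(2n)!}{2^n n!}$, with the convention $(-1)!!=1$.
   Context: For $m\geqslant 0$, $C_m$ denotes the chain $\{0<1<\dots<m\}$ with $m+1$ elements, and $C_m^n$ its $n$-th cartesian power with the componentwise order (so $C_1^n$ is the $n$-dimensional cube, and $C_m^0$ is a one-element poset). The maps $C_m^i\to C_m^{i+1}$ used for stacking are the embeddings $(x_1,\dots,x_i)\mapsto(0,x_1,\dots,x_i)$. Stacking (lax sum): given posets $M_0,\dots,M_n$ and monotone maps $f_j\colon M_j\to M_{j+1}$ ($0\leqslant j<n$), the poset $\Sigma_nM_n$ has as elements the pairs $(x,j)$ with $0\leqslant j\leqslant n$ and $x\in M_j$ (disjoint union), ordered by $(x,j)\leqslant(y,k)$ if and only if $j\leqslant k$ and $(f_{k-1}\circ\dots\circ f_j)(x)\leqslant y$ in $M_k$ (where for $j=k$ the composite is the identity). $\Sigma_nC_1^n$ denotes this construction applied to $C_1^0\to C_1^1\to\dots\to C_1^n$. -}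

module Defs where

open import Data.Nat using (ℕ; zero; suc; _+_; _*_)
open import Data.Fin using (Fin; toℕ)
open import Data.Bool using (Bool; true; false)
import Data.Bool as B
open import Data.Vec using (Vec; []; _∷_)
open import Data.Vec.Relation.Binary.Pointwise.Inductive using (Pointwise)
open import Data.Product using (Σ; _×_; _,_; ∃-syntax)
open import Data.Sum using (_⊎_)
open import Relation.Binary.PropositionalEquality using (_≡_; subst)

Cube : ℕ → Set
Cube i = Vec Bool i

_≤C_ : ∀ {i} → Cube i → Cube i → Set
x ≤C y = Pointwise B._≤_ x y

-- d-fold iterate of the stacking embedding C^i → C^{i+1}, x ↦ (0 , x)
lift : ∀ {i} (d : ℕ) → Cube i → Cube (d + i)
lift zero    x = x
lift (suc d) x = false ∷ lift d x

Elem : ℕ → Set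
Elem n = Σ (Fin (suc n)) (λ j → Cube (toℕ j))

-- (x , j) ≤ (y , k)  iff  j ≤ k and (f_{k-1} ∘ … ∘ f_j)(x) ≤ y in C_1^k
_≤Σ_ : ∀ {n} → Elem n → Elem n → Set
(j , x) ≤Σ (k , y) =
  Σ ℕ (λ d → Σ (d + toℕ j ≡ toℕ k) (λ eq → subst Cube eq (lift d x) ≤C y))

Subset : ℕ → Set
Subset n = Elem n → Bool

_∈_ : ∀ {n} → Elem n → Subset n → Set
a ∈ S = S a ≡ true

_⊆_ : ∀ {n} → Subset n → Subset n → Set
S ⊆ T = ∀ a → a ∈ S → a ∈ T

_≐_ : ∀ {n} → Subset n → Subset n → Set
S ≐ T = ∀ a → S a ≡ T a

IsChain : ∀ {n} → Subset n → Set
IsChain S = ∀ a b → a ∈ S → b ∈ S → (a ≤Σ b) ⊎ (b ≤Σ a)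

IsMaximalChain : ∀ {n} → Subset n → Set
IsMaximalChain S = IsChain S × (∀ T → IsChain T → S ⊆ T → T ⊆ S)

HasMaxChainCount : ℕ → ℕ → Set
HasMaxChainCount n N =
  Σ (Fin N → Subset n) λ f →
    (∀ i → IsMaximalChain (f i))
    × (∀ i i' → f i ≐ f i' → i ≡ i')
    × (∀ S → IsMaximalChain S → ∃[ i ] (f i ≐ S))

-- odd double factorial: oddDF n = (2n-1)!! = 1·3·…·(2n-1), with (-1)!! = 1
oddDF : ℕ → ℕ
oddDF zero    = 1
oddDF (suc n) = (2 * n + 1) * oddDF n

-- A maximal chain of a bounded graded poset is the same thing as a path
-- bot = p 0 ⋖ p 1 ⋖ ⋯ ⋖ p r = top of covers, so maximal chains can be counted by
-- summing over upper covers.  In Σ_n C_1^n the rank of (j , x) is j + |x|, and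
-- (j , x) is covered by the elements obtained from x by turning one 0 into a 1
-- and, if j < n, by (j + 1 , 0x).  Hence the number N(m , k) of paths to the top
-- from an element m layers below layer n whose cube has k zeros satisfies
-- N(m , k) = k N(m , k - 1) + N(m - 1 , k + 1), which is solved by
-- N(m , k) = (2m + 1)(2m + 2) ⋯ (2m + k) · (2m - 1)!!; the bottom element has
-- m = n and k = 0.

module Submission where

open import Data.Bool using (Bool; true; false; _∨_; f≤t; b≤b)
import Data.Bool.Properties as Bool
open import Data.Empty using (⊥; ⊥-elim)
open import Data.Fin using (Fin; zero; suc; toℕ; fromℕ; fromℕ<; splitAt; join; _↑ˡ_; _↑ʳ_)
import Data.Fin.Properties as Fin
open import Data.List using (List; []; _∷_; map; length; lookup; _++_)
open import Data.List.Properties using (length-map; map-∘; map-++)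
open import Data.List.Membership.Propositional as Membership using (find; lose)
open import Data.List.Membership.Propositional.Properties using (∈-lookup; ∈-map⁻)
open import Data.List.Relation.Unary.All as All using (All; []; _∷_)
import Data.List.Relation.Unary.All.Properties as Allₚ
open import Data.List.Relation.Unary.AllPairs using (_∷_)
open import Data.List.Relation.Unary.Any as Any using (Any; here; there; any?)
import Data.List.Relation.Unary.Any.Properties as Anyₚ
open import Data.List.Relation.Unary.Unique.Propositional using (Unique; [])
import Data.List.Relation.Unary.Unique.Propositional.Properties as Uniqueₚ
open import Data.Nat using (ℕ; zero; suc; _+_; _*_; _∸_; _≤_; _<_; z≤n; s≤s; z<s; _<?_)
open import Data.Nat.Induction using (<-wellFounded)
open import Data.Nat.ListAction using (sum)
open import Data.Nat.ListAction.Properties using (sum-++)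
open import Data.Nat.Properties
  using ( n<1+n; n≤1+n; m<m+n; m≤n+m; ≤-trans; ≤-total; m≤n⇒m<n∨m≡n; m≤n⇒m≤1+n; ≤⇒≯; <-irrefl; 0≢1+n
        ; suc-injective; +-comm; +-assoc; +-suc; +-identityʳ; +-mono-≤; +-cancelˡ-≡; +-cancelˡ-<; m∸n+n≡m
        ; *-assoc; *-suc; *-identityˡ; ≡-irrelevant)
open import Data.Nat.Tactic.RingSolver using (solve-∀)
open import Data.Product using (Σ; ∃-syntax; _×_; _,_; proj₁; proj₂)
open import Data.Product.Properties using () renaming (≡-dec to Σ-≡-dec)
open import Data.Sum using (_⊎_; inj₁; inj₂)
open import Data.Vec using ([]; _∷_; replicate)
import Data.Vec.Properties as Vec
open import Data.Vec.Relation.Binary.Pointwise.Inductive as Pointwise using ([]; _∷_)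
open import Function using (_∘_)
open import Function.Bundles using (_↔_; mk↔ₛ′; Inverse)
open import Induction.WellFounded using (Acc; acc)
open import Relation.Binary.Definitions using (DecidableEquality)
open import Relation.Binary.PropositionalEquality
open import Relation.Nullary using (¬_; yes; no; does)
open import Relation.Nullary.Decidable using (dec-true)

open import Defs using (Cube; _≤C_; lift; Elem; _≤Σ_; HasMaxChainCount; oddDF)

module _ {A : Set} where

  Unique-lookup-injective : ∀ {xs : List A} → Unique xs → ∀ i j → lookup xs i ≡ lookup xs j → i ≡ j
  Unique-lookup-injective (_ ∷ _)         zero    zero    _  = refl
  Unique-lookup-injective (x∉xs ∷ _)      zero    (suc j) eq = ⊥-elim (All.lookup x∉xs (∈-lookup j) eq)
  Unique-lookup-injective (x∉xs ∷ _)      (suc i) zero    eq = ⊥-elim (All.lookup x∉xs (∈-lookup i) (sym eq))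
  Unique-lookup-injective (_ ∷ xs-unique) (suc i) (suc j) eq =
    cong suc (Unique-lookup-injective xs-unique i j eq)

  Fin-sum-map-↔ : (g : A → ℕ) (xs : List A) →
                  Fin (sum (map g xs)) ↔ Σ (Fin (length xs)) (λ i → Fin (g (lookup xs i)))
  Fin-sum-map-↔ g xs = mk↔ₛ′ (to xs) (from xs) (to∘from xs) (from∘to xs)
    where
    to : ∀ xs → Fin (sum (map g xs)) → Σ (Fin (length xs)) (λ i → Fin (g (lookup xs i)))
    to-⊎ : ∀ x xs → Fin (g x) ⊎ Fin (sum (map g xs)) →
           Σ (Fin (length (x ∷ xs))) (λ i → Fin (g (lookup (x ∷ xs) i)))
    to (x ∷ xs) u = to-⊎ x xs (splitAt (g x) u)
    to-⊎ x xs (inj₁ v) = zero , v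
    to-⊎ x xs (inj₂ w) = let (i , v) = to xs w in suc i , v

    from : ∀ xs → Σ (Fin (length xs)) (λ i → Fin (g (lookup xs i))) → Fin (sum (map g xs))
    from (x ∷ xs) (zero  , v) = v ↑ˡ sum (map g xs)
    from (x ∷ xs) (suc i , v) = g x ↑ʳ from xs (i , v)

    to∘from : ∀ xs s → to xs (from xs s) ≡ s
    to∘from (x ∷ xs) (zero  , v) rewrite Fin.splitAt-↑ˡ (g x) v (sum (map g xs)) = refl
    to∘from (x ∷ xs) (suc i , v) rewrite Fin.splitAt-↑ʳ (g x) (sum (map g xs)) (from xs (i , v))
                                       | to∘from xs (i , v) = refl

    from∘to : ∀ xs u → from xs (to xs u) ≡ u
    from∘to (x ∷ xs) u = trans (from∘to-⊎ (splitAt (g x) u)) (Fin.join-splitAt (g x) (sum (map g xs)) u)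
      where
      from∘to-⊎ : ∀ r → from (x ∷ xs) (to-⊎ x xs r) ≡ join (g x) (sum (map g xs)) r
      from∘to-⊎ (inj₁ v) = refl
      from∘to-⊎ (inj₂ w) = cong (g x ↑ʳ_) (from∘to xs w)

sum-map-const : ∀ {A : Set} {g : A → ℕ} {c} {xs} → All (λ x → g x ≡ c) xs →
                sum (map g xs) ≡ length xs * c
sum-map-const []           = refl
sum-map-const (gx≡c ∷ all) = cong₂ _+_ gx≡c (sum-map-const all)

sum-map-++ : ∀ {A : Set} (g : A → ℕ) xs ys → sum (map g (xs ++ ys)) ≡ sum (map g xs) + sum (map g ys)
sum-map-++ g xs ys = trans (cong sum (map-++ g xs ys)) (sum-++ (map g xs) (map g ys))

-- Maximal chains of a graded poset with explicit covers

record GradedCovers (E : Set) : Set₁ where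
  field
    _⊑_            : E → E → Set
    _≟_            : DecidableEquality E
    ⊑-refl         : ∀ {a} → a ⊑ a
    ⊑-trans        : ∀ {a b c} → a ⊑ b → b ⊑ c → a ⊑ c
    rank           : E → ℕ
    rank-mono      : ∀ {a b} → a ⊑ b → rank a ≤ rank b
    rank-injective : ∀ {a b} → a ⊑ b → rank a ≡ rank b → a ≡ b
    bot top        : E
    rank-bot       : rank bot ≡ 0
    bot-⊑          : ∀ a → bot ⊑ a
    ⊑-top          : ∀ a → a ⊑ top
    covers          : E → List E
    covers-sound    : ∀ a → All (λ c → a ⊑ c × rank c ≡ suc (rank a)) (covers a)
    covers-complete : ∀ {a b} → a ⊑ b → rank a < rank b → Any (_⊑ b) (covers a)
    covers-unique   : ∀ a → Unique (covers a)

module MaximalChains {E : Set} (G : GradedCovers E) where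

  open GradedCovers G

  _⋖_ : E → E → Set
  a ⋖ c = a ⊑ c × rank c ≡ suc (rank a)

  Comparable : E → E → Set
  Comparable a b = (a ⊑ b) ⊎ (b ⊑ a)

  Comparable-sym : ∀ {a b} → Comparable a b → Comparable b a
  Comparable-sym (inj₁ a⊑b) = inj₂ a⊑b
  Comparable-sym (inj₂ b⊑a) = inj₁ b⊑a

  ⊑⇒≡∨rank< : ∀ {a b} → a ⊑ b → a ≡ b ⊎ rank a < rank b
  ⊑⇒≡∨rank< a⊑b with m≤n⇒m<n∨m≡n (rank-mono a⊑b)
  ... | inj₁ a<b = inj₂ a<b
  ... | inj₂ a≡b = inj₁ (rank-injective a⊑b a≡b)

  Comparable-rank-injective : ∀ {a b} → Comparable a b → rank a ≡ rank b → a ≡ b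
  Comparable-rank-injective (inj₁ a⊑b) eq = rank-injective a⊑b eq
  Comparable-rank-injective (inj₂ b⊑a) eq = sym (rank-injective b⊑a (sym eq))

  rank≤rank-top : ∀ a → rank a ≤ rank top
  rank≤rank-top a = rank-mono (⊑-top a)

  lookup-covers-⋖ : ∀ a i → a ⋖ lookup (covers a) i
  lookup-covers-⋖ a i = All.lookup (covers-sound a) (∈-lookup i)

  ⋖⇒lookup-covers : ∀ {a c} → a ⋖ c → ∃[ i ] lookup (covers a) i ≡ c
  ⋖⇒lookup-covers {a} {c} (a⊑c , rank-c) =
    i , rank-injective (Anyₚ.lookup-index c-above) (trans (proj₂ (lookup-covers-⋖ a i)) (sym rank-c))
    where
    c-above : Any (_⊑ c) (covers a)
    c-above = covers-complete a⊑c (subst (rank a <_) (sym rank-c) (n<1+n (rank a)))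
    i : Fin (length (covers a))
    i = Any.index c-above

  -- Subset, IsChain and IsMaximalChain of Defs for an arbitrary poset; at
  -- Σ_n C_1^n they are definitionally those of Defs.
  Subset : Set
  Subset = E → Bool

  _∈_ : E → Subset → Set
  a ∈ S = S a ≡ true

  IsChain : Subset → Set
  IsChain S = ∀ a b → a ∈ S → b ∈ S → Comparable a b

  IsMaximalChain : Subset → Set
  IsMaximalChain S = IsChain S × (∀ T → IsChain T → (∀ a → a ∈ S → a ∈ T) → ∀ a → a ∈ T → a ∈ S)

  insert : E → Subset → Subset
  insert c S a = S a ∨ does (a ≟ c)

  ∈-insert⁻ : ∀ {c S a} → a ∈ insert c S → a ∈ S ⊎ a ≡ c
  ∈-insert⁻ {c} {S} {a} a∈ with S a | a ≟ c
  ... | true  | _       = inj₁ refl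
  ... | false | yes a≡c = inj₂ a≡c

  module _ {S : Subset} (S-maximal : IsMaximalChain S) where

    private
      S-chain : IsChain S
      S-chain = proj₁ S-maximal

    comparable⇒∈ : ∀ c → (∀ s → s ∈ S → Comparable s c) → c ∈ S
    comparable⇒∈ c comparable = proj₂ S-maximal (insert c S) insert-chain S⊆insert c c∈insert
      where
      insert-chain : IsChain (insert c S)
      insert-chain a b a∈ b∈ with ∈-insert⁻ {S = S} a∈ | ∈-insert⁻ {S = S} b∈
      ... | inj₁ a∈S  | inj₁ b∈S  = S-chain a b a∈S b∈S
      ... | inj₁ a∈S  | inj₂ refl = comparable a a∈S
      ... | inj₂ refl | inj₁ b∈S  = Comparable-sym (comparable b b∈S)
      ... | inj₂ refl | inj₂ refl = inj₁ ⊑-refl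
      S⊆insert : ∀ a → a ∈ S → a ∈ insert c S
      S⊆insert a a∈S rewrite a∈S = refl
      c∈insert : c ∈ insert c S
      c∈insert with S c
      ... | true  = refl
      ... | false = dec-true (c ≟ c) refl

    bot∈ : bot ∈ S
    bot∈ = comparable⇒∈ bot (λ s _ → inj₂ (bot-⊑ s))

    top∈ : top ∈ S
    top∈ = comparable⇒∈ top (λ s _ → inj₁ (⊑-top s))

    -- By induction on the rank of s: a cover c ⊑ s of p that is not in S must be
    -- incomparable to some t ∈ S, which can only lie strictly between p and s.
    no-cover⇒no-element-above : ∀ {p} → p ∈ S → ¬ Any (_∈ S) (covers p) →
                                ∀ s → Acc _<_ (rank s) → s ∈ S → ¬ (rank p < rank s)
    no-cover⇒no-element-above {p} p∈S no-cover s (acc smaller) s∈S p<s =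
      no-cover (lose c∈covers (comparable⇒∈ c comparable))
      where
      p⊑s : p ⊑ s
      p⊑s with S-chain p s p∈S s∈S
      ... | inj₁ p⊑s = p⊑s
      ... | inj₂ s⊑p = ⊥-elim (≤⇒≯ (rank-mono s⊑p) p<s)
      c-below-s : ∃[ c ] c Membership.∈ covers p × c ⊑ s
      c-below-s = find (covers-complete p⊑s p<s)
      c : E
      c = proj₁ c-below-s
      c∈covers : c Membership.∈ covers p
      c∈covers = proj₁ (proj₂ c-below-s)
      c⊑s : c ⊑ s
      c⊑s = proj₂ (proj₂ c-below-s)
      p⋖c : p ⋖ c
      p⋖c = All.lookup (covers-sound p) c∈covers
      comparable : ∀ t → t ∈ S → Comparable t c
      comparable t t∈S with S-chain t p t∈S p∈S
      ... | inj₁ t⊑p = inj₁ (⊑-trans t⊑p (proj₁ p⋖c))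
      ... | inj₂ p⊑t with ⊑⇒≡∨rank< p⊑t
      ...   | inj₁ refl = inj₁ (proj₁ p⋖c)
      ...   | inj₂ p<t with S-chain t s t∈S s∈S
      ...     | inj₂ s⊑t = inj₂ (⊑-trans c⊑s s⊑t)
      ...     | inj₁ t⊑s with ⊑⇒≡∨rank< t⊑s
      ...       | inj₁ refl = inj₂ c⊑s
      ...       | inj₂ t<s = ⊥-elim (no-cover⇒no-element-above p∈S no-cover t (smaller t<s) t∈S p<t)

    cover-in-chain : ∀ {p} → p ∈ S → rank p < rank top → ∃[ c ] c ∈ S × p ⋖ c
    cover-in-chain {p} p∈S p<top with any? (λ c → S c Bool.≟ true) (covers p)
    ... | yes c∈S = let (c , c∈covers , c∈S) = find c∈S in c , c∈S , All.lookup (covers-sound p) c∈covers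
    ... | no no-cover =
      ⊥-elim (no-cover⇒no-element-above p∈S no-cover top (<-wellFounded (rank top)) top∈ p<top)

  record IsSaturatedChain (e : E) (f : ℕ) (p : ℕ → E) : Set where
    field
      start   : p 0 ≡ e
      ascends : ∀ t → t < f → p t ⊑ p (suc t)
      rank-at : ∀ t → t ≤ f → rank (p t) ≡ rank e + t

  open IsSaturatedChain

  module _ {e f p} (p-saturated : IsSaturatedChain e f p) where

    ascending : ∀ {t t'} → t ≤ t' → t' ≤ f → p t ⊑ p t'
    ascending {t} {t'} t≤t' t'≤f with m≤n⇒m<n∨m≡n t≤t'
    ... | inj₂ refl = ⊑-refl
    ascending {t} {suc t'} t≤t' t'<f | inj₁ (s≤s t≤t'') =
      ⊑-trans (ascending t≤t'' (≤-trans (n≤1+n t') t'<f)) (ascends p-saturated t' t'<f)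


  rank-from-bot : ∀ {f p} → IsSaturatedChain bot f p → ∀ t → t ≤ f → rank (p t) ≡ t
  rank-from-bot p-saturated t t≤f = trans (rank-at p-saturated t t≤f) (cong (_+ t) rank-bot)

  _≈⟨_⟩_ : (ℕ → E) → ℕ → (ℕ → E) → Set
  p ≈⟨ f ⟩ q = ∀ t → t ≤ f → p t ≡ q t

  -- The set {p 0 , … , p (rank top)} of a path p from bot, on which p t has rank t.
  chainOf : (ℕ → E) → Subset
  chainOf p a = does (p (rank a) ≟ a)

  ∈-chainOf⁻ : ∀ p {a} → a ∈ chainOf p → p (rank a) ≡ a
  ∈-chainOf⁻ p {a} a∈ with p (rank a) ≟ a
  ... | yes pa≡a = pa≡a

  ∈-chainOf⁺ : ∀ p {a} → p (rank a) ≡ a → a ∈ chainOf p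
  ∈-chainOf⁺ p {a} = dec-true (p (rank a) ≟ a)

  module _ {p} (p-saturated : IsSaturatedChain bot (rank top) p) where

    private
      rank-p : ∀ t → t ≤ rank top → rank (p t) ≡ t
      rank-p = rank-from-bot p-saturated

    p∈chainOf : ∀ t → t ≤ rank top → p t ∈ chainOf p
    p∈chainOf t t≤top = ∈-chainOf⁺ p (cong p (rank-p t t≤top))

    chainOf-maximal : IsMaximalChain (chainOf p)
    chainOf-maximal = chain , maximal
      where
      chain : IsChain (chainOf p)
      chain a b a∈ b∈ with ≤-total (rank a) (rank b)
      ... | inj₁ a≤b = inj₁ (subst₂ _⊑_ (∈-chainOf⁻ p a∈) (∈-chainOf⁻ p b∈)
                                    (ascending p-saturated a≤b (rank≤rank-top b)))
      ... | inj₂ b≤a = inj₂ (subst₂ _⊑_ (∈-chainOf⁻ p b∈) (∈-chainOf⁻ p a∈)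
                                    (ascending p-saturated b≤a (rank≤rank-top a)))
      maximal : ∀ T → IsChain T → (∀ a → a ∈ chainOf p → a ∈ T) → ∀ a → a ∈ T → a ∈ chainOf p
      maximal T T-chain p⊆T a a∈T =
        ∈-chainOf⁺ p (Comparable-rank-injective (T-chain _ a pa∈T a∈T) (rank-p (rank a) (rank≤rank-top a)))
        where
        pa∈T : p (rank a) ∈ T
        pa∈T = p⊆T _ (p∈chainOf (rank a) (rank≤rank-top a))

  module _ {p q} (p-saturated : IsSaturatedChain bot (rank top) p)
                 (q-saturated : IsSaturatedChain bot (rank top) q) where

    chainOf-injective : chainOf p ≗ chainOf q → p ≈⟨ rank top ⟩ q
    chainOf-injective same t t≤top = 
      sym (subst (λ r → q r ≡ p t) (rank-from-bot p-saturated t t≤top)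
                 (∈-chainOf⁻ q (trans (sym (same (p t))) (p∈chainOf p-saturated t t≤top))))

  chainOf-cong : ∀ {p q} → p ≈⟨ rank top ⟩ q → chainOf p ≗ chainOf q
  chainOf-cong {p} {q} p≈q a rewrite p≈q (rank a) (rank≤rank-top a) = refl

  module _ {S : Subset} (S-maximal : IsMaximalChain S) where

    private
      step : ∀ p → p ∈ S → ∃[ c ] c ∈ S × p ⊑ c × (rank p < rank top → rank c ≡ suc (rank p))
      step p p∈S with rank p <? rank top
      ... | yes p<top = let (c , c∈S , p⊑c , rank-c) = cover-in-chain S-maximal p∈S p<top
                        in c , c∈S , p⊑c , λ _ → rank-c
      ... | no p≮top = p , p∈S , ⊑-refl , λ p<top → ⊥-elim (p≮top p<top)

      walk : ℕ → Σ E (_∈ S)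
      walk zero    = bot , bot∈ S-maximal
      walk (suc t) = let (p , p∈S) = walk t ; (c , c∈S , _) = step p p∈S in c , c∈S

    pathThrough : ℕ → E
    pathThrough t = proj₁ (walk t)

    pathThrough-saturated : IsSaturatedChain bot (rank top) pathThrough
    pathThrough-saturated =
      record { start = refl ; ascends = λ t _ → coverPath-ascends t ; rank-at = rank-at′ }
      where
      coverPath-ascends : ∀ t → pathThrough t ⊑ pathThrough (suc t)
      coverPath-ascends t = let (p , p∈S) = walk t in proj₁ (proj₂ (proj₂ (step p p∈S)))
      rank-coverPath : ∀ t → t ≤ rank top → rank (pathThrough t) ≡ t
      rank-coverPath zero    _     = rank-bot
      rank-coverPath (suc t) t<top =
        let (p , p∈S) = walk t ; rank-p = rank-coverPath t (≤-trans (n≤1+n t) t<top)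
        in trans (proj₂ (proj₂ (proj₂ (step p p∈S))) (subst (_< rank top) (sym rank-p) t<top))
                 (cong suc rank-p)
      rank-at′ : ∀ t → t ≤ rank top → rank (pathThrough t) ≡ rank bot + t
      rank-at′ t t≤top = trans (rank-coverPath t t≤top) (cong (_+ t) (sym rank-bot))

    chainOf-pathThrough : chainOf pathThrough ≗ S
    chainOf-pathThrough a with S a in a∈?
    ... | true  = ∈-chainOf⁺ pathThrough
                    (Comparable-rank-injective (proj₁ S-maximal _ a (proj₂ (walk (rank a))) a∈?)
                                               (rank-from-bot pathThrough-saturated (rank a) (rank≤rank-top a)))
    ... | false with pathThrough (rank a) ≟ a
    ...   | yes coverPath≡a = trans (sym (subst (_∈ S) coverPath≡a (proj₂ (walk (rank a))))) a∈?
    ...   | no _     = refl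

  _◂_ : E → (ℕ → E) → ℕ → E
  (e ◂ p) zero    = e
  (e ◂ p) (suc t) = p t

  ◂-saturated : ∀ {e c f p} → e ⋖ c → IsSaturatedChain c f p → IsSaturatedChain e (suc f) (e ◂ p)
  ◂-saturated {e} {c} {f} {p} (e⊑c , rank-c) p-saturated =
    record { start = refl ; ascends = ascends′ ; rank-at = rank-at′ }
    where
    ascends′ : ∀ t → t < suc f → (e ◂ p) t ⊑ (e ◂ p) (suc t)
    ascends′ zero    _           = subst (e ⊑_) (sym (start p-saturated)) e⊑c
    ascends′ (suc t) (s≤s t<f)   = ascends p-saturated t t<f
    rank-at′ : ∀ t → t ≤ suc f → rank ((e ◂ p) t) ≡ rank e + t
    rank-at′ zero    _         = sym (+-identityʳ (rank e))
    rank-at′ (suc t) (s≤s t≤f) =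
      trans (rank-at p-saturated t t≤f) (trans (cong (_+ t) rank-c) (sym (+-suc (rank e) t)))

  module _ {e f q} (q-saturated : IsSaturatedChain e (suc f) q) where

    first-step-⋖ : e ⋖ q 1
    first-step-⋖ = subst (_⊑ q 1) (start q-saturated) (ascends q-saturated 0 (s≤s z≤n)) ,
                   trans (rank-at q-saturated 1 (s≤s z≤n)) (+-comm (rank e) 1)

    tail-saturated : IsSaturatedChain (q 1) f (λ t → q (suc t))
    tail-saturated = record
      { start   = refl
      ; ascends = λ t t<f → ascends q-saturated (suc t) (s≤s t<f)
      ; rank-at = λ t t≤f → trans (rank-at q-saturated (suc t) (s≤s t≤f))
                                  (trans (sym (+-assoc (rank e) 1 t))
                                         (cong (_+ t) (sym (rank-at q-saturated 1 (s≤s z≤n)))))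
      }

  coverPathCount : ℕ → E → ℕ
  coverPathCount zero    e = 1
  coverPathCount (suc f) e = sum (map (coverPathCount f) (covers e))

  CoverChoice : ℕ → E → Set
  CoverChoice f e = Σ (Fin (length (covers e))) λ i → Fin (coverPathCount f (lookup (covers e) i))

  choose-cover : ∀ f e → Fin (coverPathCount (suc f) e) ↔ CoverChoice f e
  choose-cover f e = Fin-sum-map-↔ (coverPathCount f) (covers e)

  coverPath   : ∀ f e → Fin (coverPathCount f e) → ℕ → E
  extendCoverPath : ∀ f e → CoverChoice f e → ℕ → E
  coverPath zero    e _ _ = e
  coverPath (suc f) e u   = extendCoverPath f e (Inverse.to (choose-cover f e) u)
  extendCoverPath f e (i , v) = e ◂ coverPath f (lookup (covers e) i) v

  coverPath-start : ∀ f e u → coverPath f e u 0 ≡ e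
  coverPath-start zero    e u = refl
  coverPath-start (suc f) e u = refl

  coverPath-saturated : ∀ f e u → IsSaturatedChain e f (coverPath f e u)
  coverPath-saturated zero    e u =
    record { start = refl ; ascends = λ _ () ; rank-at = λ { zero _ → sym (+-identityʳ (rank e)) } }
  coverPath-saturated (suc f) e u =
    let (i , v) = Inverse.to (choose-cover f e) u
    in ◂-saturated (lookup-covers-⋖ e i) (coverPath-saturated f (lookup (covers e) i) v)

  coverPath-injective   : ∀ f e u u' → coverPath f e u ≈⟨ f ⟩ coverPath f e u' → u ≡ u'
  extendCoverPath-injective : ∀ f e s s' → extendCoverPath f e s ≈⟨ suc f ⟩ extendCoverPath f e s' → s ≡ s'
  coverPath-injective zero    e zero zero _ = refl
  coverPath-injective (suc f) e u u' agree = begin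
    u             ≡⟨ sym (strictlyInverseʳ u) ⟩
    from (to u)   ≡⟨ cong from (extendCoverPath-injective f e (to u) (to u') agree) ⟩
    from (to u')  ≡⟨ strictlyInverseʳ u' ⟩
    u'            ∎
    where open Inverse (choose-cover f e)
          open ≡-Reasoning
  extendCoverPath-injective f e (i , v) (i' , v') agree
    with Unique-lookup-injective (covers-unique e) i i'
           (trans (sym (coverPath-start f _ v)) (trans (agree 1 (s≤s z≤n)) (coverPath-start f _ v')))
  ... | refl = cong (i ,_) (coverPath-injective f _ v v' (λ t t≤f → agree (suc t) (s≤s t≤f)))

  coverPath-surjective : ∀ f e q → IsSaturatedChain e f q → ∃[ u ] coverPath f e u ≈⟨ f ⟩ q
  coverPath-surjective zero    e q q-saturated = zero , λ { zero _ → sym (start q-saturated) }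
  coverPath-surjective (suc f) e q q-saturated = from (i , v) , agree
    where
    open Inverse (choose-cover f e)
    first-cover : ∃[ i ] lookup (covers e) i ≡ q 1
    first-cover = ⋖⇒lookup-covers (first-step-⋖ q-saturated)
    i : Fin (length (covers e))
    i = proj₁ first-cover
    tail : ∃[ v ] coverPath f (lookup (covers e) i) v ≈⟨ f ⟩ (λ t → q (suc t))
    tail = coverPath-surjective f _ _ (subst (λ c → IsSaturatedChain c f (λ t → q (suc t)))
                                             (sym (proj₂ first-cover)) (tail-saturated q-saturated))
    v : Fin (coverPathCount f (lookup (covers e) i))
    v = proj₁ tail
    agree : coverPath (suc f) e (from (i , v)) ≈⟨ suc f ⟩ q
    agree t t≤ rewrite strictlyInverseˡ (i , v) with t | t≤
    ... | zero  | _        = sym (start q-saturated)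
    ... | suc t | s≤s t≤f  = proj₂ tail t t≤f

  maximalChains-enumeration :
    Σ (Fin (coverPathCount (rank top) bot) → Subset) λ F →
      (∀ u → IsMaximalChain (F u))
      × (∀ u u' → F u ≗ F u' → u ≡ u')
      × (∀ S → IsMaximalChain S → ∃[ u ] F u ≗ S)
  maximalChains-enumeration = F , F-maximal , F-injective , F-surjective
    where
    F : Fin (coverPathCount (rank top) bot) → Subset
    F u = chainOf (coverPath (rank top) bot u)
    F-maximal : ∀ u → IsMaximalChain (F u)
    F-maximal u = chainOf-maximal (coverPath-saturated (rank top) bot u)
    F-injective : ∀ u u' → F u ≗ F u' → u ≡ u'
    F-injective u u' same = coverPath-injective (rank top) bot u u'
      (chainOf-injective (coverPath-saturated (rank top) bot u) (coverPath-saturated (rank top) bot u') same)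
    F-surjective : ∀ S → IsMaximalChain S → ∃[ u ] F u ≗ S
    F-surjective S S-maximal =
      let (u , agree) = coverPath-surjective (rank top) bot (pathThrough S-maximal) (pathThrough-saturated S-maximal)
      in u , λ a → trans (chainOf-cong agree a) (chainOf-pathThrough S-maximal a)

-- Cubes

ones : ∀ {a} → Cube a → ℕ
ones []          = 0
ones (true ∷ x)  = suc (ones x)
ones (false ∷ x) = ones x

zeros : ∀ {a} → Cube a → ℕ
zeros []          = 0
zeros (true ∷ x)  = zeros x
zeros (false ∷ x) = suc (zeros x)

≤C-refl : ∀ {a} {x : Cube a} → x ≤C x
≤C-refl = Pointwise.refl Bool.≤-refl

≤C-trans : ∀ {a} {x y z : Cube a} → x ≤C y → y ≤C z → x ≤C z
≤C-trans = Pointwise.trans Bool.≤-trans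

ones-mono : ∀ {a} {x y : Cube a} → x ≤C y → ones x ≤ ones y
ones-mono {x = []}        {[]}        []          = z≤n
ones-mono {x = true ∷ _}  {true ∷ _}  (_ ∷ x≤y)   = s≤s (ones-mono x≤y)
ones-mono {x = false ∷ _} {true ∷ _}  (_ ∷ x≤y)   = m≤n⇒m≤1+n (ones-mono x≤y)
ones-mono {x = false ∷ _} {false ∷ _} (_ ∷ x≤y)   = ones-mono x≤y

≤C-ones-injective : ∀ {a} {x y : Cube a} → x ≤C y → ones x ≡ ones y → x ≡ y
≤C-ones-injective {x = []}        {[]}        []        _  = refl
≤C-ones-injective {x = true ∷ _}  {true ∷ _}  (_ ∷ x≤y) eq =
  cong (true ∷_) (≤C-ones-injective x≤y (suc-injective eq))
≤C-ones-injective {x = false ∷ _} {true ∷ _}  (_ ∷ x≤y) eq = ⊥-elim (<-irrefl eq (s≤s (ones-mono x≤y)))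
≤C-ones-injective {x = false ∷ _} {false ∷ _} (_ ∷ x≤y) eq = cong (false ∷_) (≤C-ones-injective x≤y eq)

no-ones-≤C : ∀ {a} (x y : Cube a) → ones x ≡ 0 → x ≤C y
no-ones-≤C []          []      _ = []
no-ones-≤C (false ∷ x) (b ∷ y) h = Bool.≤-minimum b ∷ no-ones-≤C x y h

≤C-all-true : ∀ {a} (x : Cube a) → x ≤C replicate a true
≤C-all-true []          = []
≤C-all-true (false ∷ x) = f≤t ∷ ≤C-all-true x
≤C-all-true (true ∷ x)  = b≤b ∷ ≤C-all-true x

ones-all-true : ∀ a → ones (replicate a true) ≡ a
ones-all-true zero    = refl
ones-all-true (suc a) = cong suc (ones-all-true a)

ones-subst : ∀ {a b} (eq : a ≡ b) (x : Cube a) → ones (subst Cube eq x) ≡ ones x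
ones-subst refl x = refl

zeros-subst : ∀ {a b} (eq : a ≡ b) (x : Cube a) → zeros (subst Cube eq x) ≡ zeros x
zeros-subst refl x = refl

subst-irrelevant : ∀ {a b} (eq eq′ : a ≡ b) (x : Cube a) → subst Cube eq x ≡ subst Cube eq′ x
subst-irrelevant eq eq′ x = cong (λ e → subst Cube e x) (≡-irrelevant eq eq′)

subst-∷ : ∀ {a b} (eq : suc a ≡ suc b) c (x : Cube a) →
          subst Cube eq (c ∷ x) ≡ c ∷ subst Cube (suc-injective eq) x
subst-∷ refl c x = refl

ones-lift : ∀ {a} d (x : Cube a) → ones (lift d x) ≡ ones x
ones-lift zero    x = refl
ones-lift (suc d) x = ones-lift d x

lift-mono : ∀ {a} d {x y : Cube a} → x ≤C y → lift d x ≤C lift d y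
lift-mono zero    x≤y = x≤y
lift-mono (suc d) x≤y = b≤b ∷ lift-mono d x≤y

lift-+ : ∀ {a} d′ d (x : Cube a) → subst Cube (+-assoc d′ d a) (lift (d′ + d) x) ≡ lift d′ (lift d x)
lift-+ zero     d x = subst-irrelevant _ refl _
lift-+ (suc d′) d x = trans (subst-∷ (+-assoc (suc d′) d _) false _)
  (cong (false ∷_) (trans (subst-irrelevant _ (+-assoc d′ d _) _) (lift-+ d′ d x)))

lift-suc : ∀ {a} d (x : Cube a) → subst Cube (+-suc d a) (lift d (false ∷ x)) ≡ false ∷ lift d x
lift-suc zero    x = subst-irrelevant _ refl _
lift-suc (suc d) x = trans (subst-∷ (+-suc (suc d) _) false _)
  (cong (false ∷_) (trans (subst-irrelevant _ (+-suc d _) _) (lift-suc d x)))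

-- (j , x) ≤Σ (k , y) is x ≼ y.
_≼_ : ∀ {a b} → Cube a → Cube b → Set
_≼_ {a} {b} x y = Σ ℕ λ d → Σ (d + a ≡ b) λ eq → subst Cube eq (lift d x) ≤C y

≼-trans : ∀ {a b c} {x : Cube a} {y : Cube b} {z : Cube c} → x ≼ y → y ≼ z → x ≼ z
≼-trans {a} {x = x} {z = z} (d , refl , x≤y) (d′ , refl , y≤z) =
  d′ + d , +-assoc d′ d a , subst (_≤C z) (sym (lift-+ d′ d x)) (≤C-trans (lift-mono d′ x≤y) y≤z)

≼-rank-mono : ∀ {a b} {x : Cube a} {y : Cube b} → x ≼ y → a + ones x ≤ b + ones y
≼-rank-mono {a} {x = x} (d , refl , x≤y) =
  +-mono-≤ (m≤n+m a d) (subst (_≤ _) (ones-lift d x) (ones-mono x≤y))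

≼-rank-injective : ∀ {a b} {x : Cube a} {y : Cube b} → x ≼ y → a + ones x ≡ b + ones y →
                   Σ (a ≡ b) λ eq → subst Cube eq x ≡ y
≼-rank-injective {a} (zero , refl , x≤y) eq = refl , ≤C-ones-injective x≤y (+-cancelˡ-≡ a _ _ eq)
≼-rank-injective {a} {x = x} (suc d , refl , x≤y) eq =
  ⊥-elim (<-irrefl eq (s≤s (+-mono-≤ (m≤n+m a d) (subst (_≤ _) (ones-lift (suc d) x) (ones-mono x≤y)))))

≼-substˡ : ∀ {a a′ b} (eq : a ≡ a′) {x : Cube a} {y : Cube b} → x ≼ y → subst Cube eq x ≼ y
≼-substˡ refl x≼y = x≼y

false∷-≼ : ∀ {a b} {x : Cube a} {y : Cube b} d (eq : suc d + a ≡ b) →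
           subst Cube eq (lift (suc d) x) ≤C y → (false ∷ x) ≼ y
false∷-≼ {a} {x = x} {y} d refl x≤y = d , +-suc d a , subst (_≤C y) (sym (lift-suc d x)) x≤y

flips : ∀ {a} → Cube a → List (Cube a)
flips []          = []
flips (false ∷ x) = (true ∷ x) ∷ map (false ∷_) (flips x)
flips (true ∷ x)  = map (true ∷_) (flips x)

IsFlip : ∀ {a} → Cube a → Cube a → Set
IsFlip x y = x ≤C y × ones y ≡ suc (ones x) × suc (zeros y) ≡ zeros x

flips-sound : ∀ {a} (x : Cube a) → All (IsFlip x) (flips x)
flips-sound []          = []
flips-sound (false ∷ x) = (f≤t ∷ ≤C-refl , refl , refl) ∷
  Allₚ.gmap⁺ (λ (x≤y , ones-y , zeros-y) → b≤b ∷ x≤y , ones-y , cong suc zeros-y) (flips-sound x)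
flips-sound (true ∷ x)  =
  Allₚ.gmap⁺ (λ (x≤y , ones-y , zeros-y) → b≤b ∷ x≤y , cong suc ones-y , zeros-y) (flips-sound x)

flips-complete : ∀ {a} {x y : Cube a} → x ≤C y → ones x < ones y → Any (_≤C y) (flips x)
flips-complete {x = false ∷ _} {true ∷ _}  (_ ∷ x≤y) _          = here (b≤b ∷ x≤y)
flips-complete {x = false ∷ _} {false ∷ _} (_ ∷ x≤y) x<y       = there (Anyₚ.gmap (b≤b ∷_) (flips-complete x≤y x<y))
flips-complete {x = true ∷ _}  {true ∷ _}  (_ ∷ x≤y) (s≤s x<y) = Anyₚ.gmap (b≤b ∷_) (flips-complete x≤y x<y)

flips-unique : ∀ {a} (x : Cube a) → Unique (flips x)
flips-unique []          = []
flips-unique (false ∷ x) =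
  Allₚ.map⁺ (All.universal (λ _ ()) (flips x)) ∷ Uniqueₚ.map⁺ Vec.∷-injectiveʳ (flips-unique x)
flips-unique (true ∷ x)  = Uniqueₚ.map⁺ Vec.∷-injectiveʳ (flips-unique x)

length-flips : ∀ {a} (x : Cube a) → length (flips x) ≡ zeros x
length-flips []          = refl
length-flips (false ∷ x) = cong suc (trans (length-map (false ∷_) (flips x)) (length-flips x))
length-flips (true ∷ x)  = trans (length-map (true ∷_) (flips x)) (length-flips x)


no-flips : ∀ {a} (x : Cube a) → zeros x ≡ 0 → flips x ≡ []
no-flips x zeros-x with flips x | length-flips x
... | []    | _ = refl
... | _ ∷ _ | length-x = ⊥-elim (0≢1+n (trans (sym zeros-x) (sym length-x)))

-- The stacking Σ_n C_1^n

risingFactorial : ℕ → ℕ → ℕ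
risingFactorial x zero    = 1
risingFactorial x (suc k) = (x + k) * risingFactorial x k

risingFactorial-suc : ∀ x k → risingFactorial x (suc k) ≡ x * risingFactorial (suc x) k
risingFactorial-suc x zero    = cong (_* 1) (+-identityʳ x)
risingFactorial-suc x (suc k) = begin
  (x + suc k) * ((x + k) * risingFactorial x k)     ≡⟨ cong ((x + suc k) *_) (risingFactorial-suc x k) ⟩
  (x + suc k) * (x * risingFactorial (suc x) k)     ≡⟨ arithmetic x k (risingFactorial (suc x) k) ⟩
  x * ((suc x + k) * risingFactorial (suc x) k)     ∎
  where
  open ≡-Reasoning
  arithmetic : ∀ x k r → (x + suc k) * (x * r) ≡ x * ((suc x + k) * r)
  arithmetic = solve-∀

-- The number of paths of covers to the top of Σ_n C_1^n from an element m layers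
-- below layer n whose cube has k zeros.
pathsToTop : ℕ → ℕ → ℕ
pathsToTop zero    zero    = 1
pathsToTop zero    (suc k) = suc k * pathsToTop zero k
pathsToTop (suc m) zero    = pathsToTop m 1
pathsToTop (suc m) (suc k) = suc k * pathsToTop (suc m) k + pathsToTop m (suc (suc k))

pathsToTop-closed : ∀ m k → pathsToTop m k ≡ risingFactorial (suc (2 * m)) k * oddDF m
pathsToTop-closed zero    zero    = refl
pathsToTop-closed zero    (suc k) =
  trans (cong (suc k *_) (pathsToTop-closed zero k)) (sym (*-assoc (suc k) (risingFactorial 1 k) 1))
pathsToTop-closed (suc m) zero    = trans (pathsToTop-closed m 1) (arithmetic m (oddDF m))
  where
  arithmetic : ∀ m o → ((suc (2 * m) + 0) * 1) * o ≡ 1 * ((2 * m + 1) * o)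
  arithmetic = solve-∀
pathsToTop-closed (suc m) (suc k) = begin
  suc k * pathsToTop (suc m) k + pathsToTop m (suc (suc k))
    ≡⟨ cong₂ _+_ (cong (suc k *_) (pathsToTop-closed (suc m) k)) (pathsToTop-closed m (suc (suc k))) ⟩
  suc k * (r * oddDF (suc m)) + risingFactorial (suc (2 * m)) (suc (suc k)) * oddDF m
    ≡⟨ cong (λ y → suc k * (r * oddDF (suc m)) + y * oddDF m) two-factors ⟩
  suc k * (r * oddDF (suc m)) + suc (2 * m) * (suc (suc (2 * m)) * r) * oddDF m
    ≡⟨ arithmetic m k r (oddDF m) ⟩
  (suc (2 * suc m) + k) * r * oddDF (suc m)
    ∎
  where
  open ≡-Reasoning
  r : ℕ
  r = risingFactorial (suc (2 * suc m)) k
  two-factors : risingFactorial (suc (2 * m)) (suc (suc k)) ≡ suc (2 * m) * (suc (suc (2 * m)) * r)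
  two-factors = trans (risingFactorial-suc (suc (2 * m)) (suc k))
    (cong (suc (2 * m) *_) (trans (risingFactorial-suc (suc (suc (2 * m))) k)
                                  (cong (λ y → suc (suc (2 * m)) * risingFactorial (suc y) k) (sym (*-suc 2 m)))))
  arithmetic : ∀ m k r o → suc k * (r * ((2 * m + 1) * o)) + suc (2 * m) * (suc (suc (2 * m)) * r) * o
                           ≡ (suc (2 * suc m) + k) * r * ((2 * m + 1) * o)
  arithmetic = solve-∀

remaining-after-flip : ∀ m k {f} → suc f ≡ 2 * m + suc k → f ≡ 2 * m + k
remaining-after-flip m k eq = suc-injective (trans eq (+-suc (2 * m) k))

remaining-after-raise : ∀ m k {f} → suc f ≡ 2 * suc m + k → f ≡ 2 * m + suc k
remaining-after-raise m k eq = suc-injective (trans eq (arithmetic m k))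
  where
  arithmetic : ∀ m k → 2 * suc m + k ≡ suc (2 * m + suc k)
  arithmetic = solve-∀

module Stacking (n : ℕ) where

  rank : Elem n → ℕ
  rank (j , x) = toℕ j + ones x

  _≟_ : DecidableEquality (Elem n)
  _≟_ = Σ-≡-dec Fin._≟_ (Vec.≡-dec Bool._≟_)

  rank-injective : ∀ {a b} → a ≤Σ b → rank a ≡ rank b → a ≡ b
  rank-injective {j , x} {k , y} a≤b eq with ≼-rank-injective a≤b eq
  ... | j≡k , x≡y with Fin.toℕ-injective j≡k
  ... | refl = cong (j ,_) (trans (subst-irrelevant refl j≡k x) x≡y)

  bot top : Elem n
  bot = zero , []
  top = fromℕ n , replicate (toℕ (fromℕ n)) true

  rank-top : rank top ≡ n + n
  rank-top = trans (cong (toℕ (fromℕ n) +_) (ones-all-true _))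
                   (cong₂ _+_ (Fin.toℕ-fromℕ n) (Fin.toℕ-fromℕ n))

  bot-⊑ : ∀ a → bot ≤Σ a
  bot-⊑ (k , y) = toℕ k , +-identityʳ (toℕ k) ,
    no-ones-≤C _ y (trans (ones-subst (+-identityʳ (toℕ k)) (lift (toℕ k) [])) (ones-lift (toℕ k) []))

  ⊑-top : ∀ a → a ≤Σ top
  ⊑-top (j , x) = toℕ (fromℕ n) ∸ toℕ j ,
    m∸n+n≡m (subst (toℕ j ≤_) (sym (Fin.toℕ-fromℕ n)) (Fin.toℕ≤pred[n] j)) , ≤C-all-true _

  raise : (j : Fin (suc n)) → Cube (toℕ j) → List (Elem n)
  raise j x with toℕ j <? n
  ... | yes j<n = (fromℕ< (s≤s j<n) , subst Cube (sym (Fin.toℕ-fromℕ< (s≤s j<n))) (false ∷ x)) ∷ []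
  ... | no _    = []

  covers : Elem n → List (Elem n)
  covers (j , x) = map (j ,_) (flips x) ++ raise j x

  IsRaise : ∀ j x → Elem n → Set
  IsRaise j x (k , y) = (j , x) ≤Σ (k , y) × toℕ k ≡ suc (toℕ j) × ones y ≡ ones x × zeros y ≡ suc (zeros x)

  raise-sound : ∀ j x → All (IsRaise j x) (raise j x)
  raise-sound j x with toℕ j <? n
  ... | yes j<n =
    ((1 , sym level , ≤C-refl) , level , ones-subst (sym level) _ , zeros-subst (sym level) _) ∷ []
    where level = Fin.toℕ-fromℕ< (s≤s j<n)
  ... | no _    = []

  raise-complete : ∀ j (x : Cube (toℕ j)) {k} (y : Cube (toℕ k)) d (eq : suc d + toℕ j ≡ toℕ k) →
                   subst Cube eq (lift (suc d) x) ≤C y → Any (_≤Σ (k , y)) (raise j x)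
  raise-complete j x {k} y d eq x≤y with toℕ j <? n
  ... | yes j<n = here (≼-substˡ (sym (Fin.toℕ-fromℕ< (s≤s j<n))) (false∷-≼ d eq x≤y))
  ... | no j≮n  =
    ⊥-elim (j≮n (≤-trans (subst (suc (toℕ j) ≤_) eq (s≤s (m≤n+m (toℕ j) d))) (Fin.toℕ≤pred[n] k)))

  raise-unique : ∀ j x → Unique (raise j x)
  raise-unique j x with toℕ j <? n
  ... | yes _ = [] ∷ []
  ... | no _  = []

  covers-sound : ∀ a → All (λ c → a ≤Σ c × rank c ≡ suc (rank a)) (covers a)
  covers-sound (j , x) = Allₚ.++⁺
    (Allₚ.gmap⁺ (λ (x≤y , ones-y , _) →
                   (0 , refl , x≤y) , trans (cong (toℕ j +_) ones-y) (+-suc (toℕ j) (ones x)))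
                (flips-sound x))
    (All.map (λ (a≤c , level , ones-c , _) → a≤c , cong₂ _+_ level ones-c) (raise-sound j x))

  covers-complete : ∀ {a b} → a ≤Σ b → rank a < rank b → Any (_≤Σ b) (covers a)
  covers-complete {j , x} {k , y} (zero , j≡k , x≤y) a<b with Fin.toℕ-injective j≡k
  ... | refl = Anyₚ.++⁺ˡ (Anyₚ.gmap (λ x≤z → 0 , refl , x≤z)
                 (flips-complete (subst (_≤C y) (subst-irrelevant j≡k refl x) x≤y)
                                 (+-cancelˡ-< (toℕ j) _ _ a<b)))
  covers-complete {j , x} {k , y} (suc d , eq , x≤y) _ =
    Anyₚ.++⁺ʳ (map (j ,_) (flips x)) (raise-complete j x y d eq x≤y)

  covers-unique : ∀ a → Unique (covers a)
  covers-unique (j , x) = Uniqueₚ.++⁺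
    (Uniqueₚ.map⁺ (λ { refl → refl }) (flips-unique x)) (raise-unique j x) different-levels
    where
    different-levels : ∀ {c} → c Membership.∈ map (j ,_) (flips x) × c Membership.∈ raise j x → ⊥
    different-levels (c∈flips , c∈raise) with ∈-map⁻ (j ,_) c∈flips
    ... | _ , _ , refl = <-irrefl (proj₁ (proj₂ (All.lookup (raise-sound j x) c∈raise))) (n<1+n (toℕ j))

  stacking : GradedCovers (Elem n)
  stacking = record
    { _⊑_             = _≤Σ_
    ; _≟_             = _≟_
    ; ⊑-refl          = 0 , refl , ≤C-refl
    ; ⊑-trans         = ≼-trans
    ; rank            = rank
    ; rank-mono       = ≼-rank-mono
    ; rank-injective  = rank-injective
    ; bot             = bot
    ; top             = top
    ; rank-bot        = refl
    ; bot-⊑           = bot-⊑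
    ; ⊑-top           = ⊑-top
    ; covers          = covers
    ; covers-sound    = covers-sound
    ; covers-complete = covers-complete
    ; covers-unique   = covers-unique
    }

  open MaximalChains stacking public using (coverPathCount; maximalChains-enumeration)

  coverPathCount-suc : ∀ f j x → coverPathCount (suc f) (j , x) ≡
                       sum (map (coverPathCount f) (map (j ,_) (flips x)))
                       + sum (map (coverPathCount f) (raise j x))
  coverPathCount-suc f j x = sum-map-++ (coverPathCount f) (map (j ,_) (flips x)) (raise j x)

  flips-coverPathCount : ∀ f {j} x {k c} → zeros x ≡ suc k →
                         (∀ y → zeros y ≡ k → coverPathCount f (j , y) ≡ c) →
                         sum (map (coverPathCount f) (map (j ,_) (flips x))) ≡ suc k * c
  flips-coverPathCount f {j} x {k} {c} zeros-x count = begin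
    sum (map (coverPathCount f) (map (j ,_) (flips x)))
      ≡⟨ cong sum (sym (map-∘ (flips x))) ⟩
    sum (map (λ y → coverPathCount f (j , y)) (flips x))
      ≡⟨ sum-map-const (All.map flip-count (flips-sound x)) ⟩
    length (flips x) * c
      ≡⟨ cong (_* c) (trans (length-flips x) zeros-x) ⟩
    suc k * c
      ∎
    where
    open ≡-Reasoning
    flip-count : ∀ {y} → IsFlip x y → coverPathCount f (j , y) ≡ c
    flip-count (_ , _ , zeros-y) = count _ (suc-injective (trans zeros-y zeros-x))

  raise-coverPathCount : ∀ f m {j x k v} → toℕ j + suc m ≡ n → zeros x ≡ k →
                         (∀ {i y} → toℕ i + m ≡ n → zeros y ≡ suc k → coverPathCount f (i , y) ≡ v) →
                         sum (map (coverPathCount f) (raise j x)) ≡ v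
  raise-coverPathCount f m {j} {x} {k} {v} level zeros-x count =
    trans (sum-map-const (All.map raised-count (raise-sound j x)))
          (trans (cong (_* v) raise-singleton) (+-identityʳ v))
    where
    raised-count : ∀ {c} → IsRaise j x c → coverPathCount f c ≡ v
    raised-count (_ , raised-level , _ , zeros-c) =
      count (trans (cong (_+ m) raised-level) (trans (sym (+-suc (toℕ j) m)) level))
            (trans zeros-c (cong suc zeros-x))
    raise-singleton : length (raise j x) ≡ 1
    raise-singleton with toℕ j <? n
    ... | yes _   = refl
    ... | no j≮n = ⊥-elim (j≮n (subst (toℕ j <_) level (m<m+n (toℕ j) z<s)))

  raise-top : ∀ {j} (x : Cube (toℕ j)) → toℕ j ≡ n → raise j x ≡ []
  raise-top {j} x j≡n with toℕ j <? n
  ... | yes j<n = ⊥-elim (<-irrefl j≡n j<n)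
  ... | no _    = refl

  coverPathCount≡pathsToTop : ∀ f m k {j x} → toℕ j + m ≡ n → zeros x ≡ k → f ≡ 2 * m + k →
                              coverPathCount f (j , x) ≡ pathsToTop m k
  coverPathCount≡pathsToTop zero    zero    zero    _ _ _ = refl
  coverPathCount≡pathsToTop (suc f) zero    (suc k) {j} {x} level zeros-x length =
    trans (coverPathCount-suc f j x) (trans (cong₂ _+_ flipped raised) (+-identityʳ _))
    where
    flipped : sum (map (coverPathCount f) (map (j ,_) (flips x))) ≡ suc k * pathsToTop zero k
    flipped = flips-coverPathCount f x zeros-x λ y zeros-y →
      coverPathCount≡pathsToTop f zero k level zeros-y (remaining-after-flip 0 k length)
    raised : sum (map (coverPathCount f) (raise j x)) ≡ 0
    raised = cong (sum ∘ map (coverPathCount f)) (raise-top x (trans (sym (+-identityʳ _)) level))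
  coverPathCount≡pathsToTop (suc f) (suc m) zero    {j} {x} level zeros-x length =
    trans (coverPathCount-suc f j x) (cong₂ _+_ flipped raised)
    where
    flipped : sum (map (coverPathCount f) (map (j ,_) (flips x))) ≡ 0
    flipped = cong (sum ∘ map (coverPathCount f) ∘ map (j ,_)) (no-flips x zeros-x)
    raised : sum (map (coverPathCount f) (raise j x)) ≡ pathsToTop m 1
    raised = raise-coverPathCount f m level zeros-x λ level′ zeros-y →
      coverPathCount≡pathsToTop f m 1 level′ zeros-y (remaining-after-raise m 0 length)
  coverPathCount≡pathsToTop (suc f) (suc m) (suc k) {j} {x} level zeros-x length =
    trans (coverPathCount-suc f j x) (cong₂ _+_ flipped raised)
    where
    flipped : sum (map (coverPathCount f) (map (j ,_) (flips x))) ≡ suc k * pathsToTop (suc m) k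
    flipped = flips-coverPathCount f x zeros-x λ y zeros-y →
      coverPathCount≡pathsToTop f (suc m) k level zeros-y (remaining-after-flip (suc m) k length)
    raised : sum (map (coverPathCount f) (raise j x)) ≡ pathsToTop m (suc (suc k))
    raised = raise-coverPathCount f m level zeros-x λ level′ zeros-y →
      coverPathCount≡pathsToTop f m (suc (suc k)) level′ zeros-y (remaining-after-raise m (suc k) length)
  coverPathCount≡pathsToTop zero    zero    (suc k) _ _ ()
  coverPathCount≡pathsToTop zero    (suc m) k       _ _ ()
  coverPathCount≡pathsToTop (suc f) zero    zero    _ _ ()

theorem1p1 : (n : ℕ) → HasMaxChainCount n (oddDF n)
theorem1p1 n = subst (HasMaxChainCount n) maximal-chain-count maximalChains-enumeration
  where
  open Stacking n
  maximal-chain-count : coverPathCount (rank top) bot ≡ oddDF n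
  maximal-chain-count = begin
    coverPathCount (rank top) bot
      ≡⟨ coverPathCount≡pathsToTop (rank top) n 0 refl refl (trans rank-top (n+n≡2*n+0 n)) ⟩
    pathsToTop n 0
      ≡⟨ pathsToTop-closed n 0 ⟩
    1 * oddDF n
      ≡⟨ *-identityˡ (oddDF n) ⟩
    oddDF n
      ∎
    where
    open ≡-Reasoning
    n+n≡2*n+0 : ∀ n → n + n ≡ 2 * n + 0
    n+n≡2*n+0 = solve-∀
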